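{- For every base $\mathcal{B}$, atomic multisets $L,K$ and formula $\chi$: if $\Vdash^{L}_{\mathcal{B}}1$ and $\Vdash^{K}_{\mathcal{B}}\chi$, then $\Vdash^{L\uplus K}_{\mathcal{B}}\chi$.
   Context: Fix a set $\mathbb{A}$ of propositional atoms. All multisets are finite; $\uplus$ denotes multiset union; an atomic multiset is a finite multiset of atoms. Formulae: $\varphi ::= p\in\mathbb{A}\mid\top\mid 0\mid 1\mid\varphi\multimap\varphi\mid\varphi\otimes\varphi\mid\varphi\mathbin{\&}\varphi\mid\varphi\oplus\varphi\mid\,!\varphi$. Bases. An atomic sequent is a pair $P\Rightarrow p$ ($P$ atomic multiset, $p$ atom); an atomic box is a finite multiset of atomic sequents; an atomic rule is a triple $\langle\mathbf{A},\mathbf{S},p\rangle$ with $\mathbf{A}$ a finite multiset of atomic boxes, $\mathbf{S}$ an atomic box, $p$ an atom. A base is a set of atomic rules; $\mathcal{C}\supseteq\mathcal{B}$ is set inclusion. An atom $p$ is persistent in $\mathcal{B}$ if $\mathcal{B}$ contains a rule $\langle\varnothing,\mathbf{S},p\rangle$ with $\mathbf{S}\neq\varnothing$. Derivability $P\vdash_{\mathcal{B}}p$ is the smallest relation closed under: (Ref) $\{p\}\vdash_{\mathcal{B}}p$; (App) if $\langle\mathbf{A},\mathbf{S},p\rangle\in\mathcal{B}$ with $\mathbf{A}=\{\mathbf{T}_1,\dots,\mathbf{T}_m\}$, and there are $n\ge m$, atomic multisets $C_1,\dots,C_n$ and a multiset $D=\{d_{m+1},\dots,d_n\}$ of atoms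 persistent in $\mathcal{B}$ with $C_i\uplus Q\vdash_{\mathcal{B}}q$ for all $i\le m$ and $Q\Rightarrow q\in\mathbf{T}_i$, $C_j\vdash_{\mathcal{B}}d_j$ for all $m<j\le n$, and $D\uplus U\vdash_{\mathcal{B}}v$ for all $U\Rightarrow v\in\mathbf{S}$, then $C_1\uplus\dots\uplus C_n\vdash_{\mathcal{B}}p$. Support. For a base $\mathcal{B}$, atomic multiset $L$: (At) $\Vdash^L_{\mathcal{B}}p$ iff $L\vdash_{\mathcal{B}}p$; ($\multimap$) $\Vdash^L_{\mathcal{B}}\varphi\multimap\psi$ iff $\varphi\Vdash^L_{\mathcal{B}}\psi$; ($\otimes$) $\Vdash^L_{\mathcal{B}}\varphi\otimes\psi$ iff for all $\mathcal{C}\supseteq\mathcal{B}$, atomic multisets $K$, atoms $p$: if $\{\varphi,\psi\}\Vdash^K_{\mathcal{C}}p$ then $\Vdash^{L\uplus K}_{\mathcal{C}}p$; ($1$) $\Vdash^L_{\mathcal{B}}1$ iff for all $\mathcal{C}\supseteq\mathcal{B}$, $K$, $p$: if $\Vdash^K_{\mathcal{C}}p$ then $\Vdash^{L\uplus K}_{\mathcal{C}}p$; ($\mathbin{\&}$) $\Vdash^L_{\mathcal{B}}\varphi\mathbin{\&}\psi$ iff $\Vdash^L_{\mathcal{B}}\varphi$ and $\Vdash^L_{\mathcal{B}}\psi$; ($\oplus$) $\Vdash^L_{\mathcal{B}}\varphi\oplus\psi$ iff for all $\mathcal{C}\supseteq\mathcal{B}$, $K$, $p$: if $\varphi\Vdash^K_{\mathcal{C}}p$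 and $\psi\Vdash^K_{\mathcal{C}}p$ then $\Vdash^{L\uplus K}_{\mathcal{C}}p$; ($0$) $\Vdash^L_{\mathcal{B}}0$ iff $\Vdash^{L\uplus K}_{\mathcal{B}}p$ for all atoms $p$ and atomic multisets $K$; ($\top$) $\Vdash^L_{\mathcal{B}}\top$ always; ($!$) $\Vdash^L_{\mathcal{B}}\,!\varphi$ iff for all $\mathcal{C}\supseteq\mathcal{B}$, $K$, $p$: if (for all $\mathcal{D}\supseteq\mathcal{C}$, $\Vdash^{\varnothing}_{\mathcal{D}}\varphi$ implies $\Vdash^K_{\mathcal{D}}p$) then $\Vdash^{L\uplus K}_{\mathcal{C}}p$. Multisets: $\Vdash^L_{\mathcal{B}}\varnothing$ iff $L=\varnothing$; $\Vdash^L_{\mathcal{B}}\{\varphi\}$ iff $\Vdash^L_{\mathcal{B}}\varphi$; $\Vdash^L_{\mathcal{B}}\Gamma\uplus\Delta$ iff $L=K\uplus M$ for some $K,M$ with $\Vdash^K_{\mathcal{B}}\Gamma$, $\Vdash^M_{\mathcal{B}}\Delta$. (Inf) For non-empty $\Gamma$, write $\Gamma=\,!\Delta\uplus\Theta$ with $!\Delta$ the elements whose top-level connective is $!$ and $\Theta$ the rest; $\Gamma\Vdash^L_{\mathcal{B}}\varphi$ iff for all $\mathcal{C}\supseteq\mathcal{B}$ and atomic $K$: if $\Vdash^{\varnothing}_{\mathcal{C}}\delta$ for every $\delta\in\Delta$ and $\Vdash^K_{\mathcal{C}}\Theta$, then $\Vdash^{L\uplus K}_{\mathcal{C}}\varphi$.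 For $\Gamma=\varnothing$, $\Gamma\Vdash^L_{\mathcal{B}}\varphi$ means $\Vdash^L_{\mathcal{B}}\varphi$. -}

module Defs where

open import Level using (Level)
open import Data.Unit using (⊤)
open import Data.List using (List; []; _∷_; _++_; concat; map)
open import Data.List.Relation.Unary.All using (All)
open import Data.List.Relation.Binary.Pointwise using (Pointwise)
open import Data.List.Relation.Binary.Permutation.Propositional using (_↭_)
open import Data.Product using (Σ; _×_; _,_; proj₁; proj₂; ∃)
open import Relation.Binary.PropositionalEquality using (_≢_)

-- Finite multisets are represented by lists, considered up to permutation (_↭_);
-- multiset union is _++_.

data Formula (Atom : Set) : Set where
  atom  : Atom → Formula Atom
  `⊤    : Formula Atom
  `0    : Formula Atom
  `1    : Formula Atom
  _⊸_   : Formula Atom → Formula Atom → Formula Atom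
  _⊗_   : Formula Atom → Formula Atom → Formula Atom
  _&_   : Formula Atom → Formula Atom → Formula Atom
  _⊕_   : Formula Atom → Formula Atom → Formula Atom
  `!    : Formula Atom → Formula Atom

record Sequent (Atom : Set) : Set where
  constructor _⇒_
  field
    ante : List Atom
    succ : Atom
open Sequent public

Box : Set → Set
Box Atom = List (Sequent Atom)

record Rule (Atom : Set) : Set where
  constructor ⟨_,_,_⟩
  field
    boxes : List (Box Atom)
    side  : Box Atom
    concl : Atom
open Rule public

Base : Set → Set₁
Base Atom = Rule Atom → Set

_⊇_ : {Atom : Set} → Base Atom → Base Atom → Set
C ⊇ B = ∀ r → B r → C r

Persistent : {Atom : Set} → Base Atom → Atom → Set
Persistent {Atom} B p = Σ (Box Atom) λ S → (S ≢ []) × B ⟨ [] , S , p ⟩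

data Derives {Atom : Set} (B : Base Atom) : List Atom → Atom → Set where
  ref : ∀ {P p} → P ↭ (p ∷ []) → Derives B P p
  app : ∀ {P} (r : Rule Atom) → B r →
        -- C_1 … C_m, one for each box T_i of r
        (cs : List (List Atom)) →
        Pointwise (λ T C → All (λ s → Derives B (C ++ ante s) (succ s)) T) (boxes r) cs →
        -- pairs (C_j , d_j) for m < j ≤ n
        (ds : List (List Atom × Atom)) →
        All (λ cd → Persistent B (proj₂ cd)) ds →
        All (λ cd → Derives B (proj₁ cd) (proj₂ cd)) ds →
        All (λ s → Derives B (map proj₂ ds ++ ante s) (succ s)) (side r) →
        P ↭ (concat cs ++ concat (map proj₁ ds)) →
        Derives B P (concl r)

mutual
  Sup : {Atom : Set} → Base Atom → List Atom → Formula Atom → Set₁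
  Sup B L (atom p) = Level.Lift (Level.suc Level.zero) (Derives B L p)
  Sup B L `⊤ = Level.Lift (Level.suc Level.zero) ⊤
  Sup {Atom} B L `0 = ∀ (p : Atom) (K : List Atom) → Sup B (L ++ K) (atom p)
  Sup {Atom} B L `1 = ∀ (C : Base Atom) → C ⊇ B → ∀ (K : List Atom) (p : Atom) →
        Sup C K (atom p) → Sup C (L ++ K) (atom p)
  Sup {Atom} B L (φ ⊸ ψ) = ∀ (C : Base Atom) → C ⊇ B → ∀ (K : List Atom) →
        Hyp C K φ → Sup C (L ++ K) ψ
  Sup {Atom} B L (φ ⊗ ψ) = ∀ (C : Base Atom) → C ⊇ B → ∀ (K : List Atom) (p : Atom) →
        (∀ (D : Base Atom) → D ⊇ C → ∀ (M : List Atom) →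
          (Σ (List Atom) λ M₁ → Σ (List Atom) λ M₂ →
             (M ↭ (M₁ ++ M₂)) × Hyp D M₁ φ × Hyp D M₂ ψ) →
          Sup D (K ++ M) (atom p)) →
        Sup C (L ++ K) (atom p)
  Sup B L (φ & ψ) = Sup B L φ × Sup B L ψ
  Sup {Atom} B L (φ ⊕ ψ) = ∀ (C : Base Atom) → C ⊇ B → ∀ (K : List Atom) (p : Atom) →
        (∀ (D : Base Atom) → D ⊇ C → ∀ (M : List Atom) → Hyp D M φ → Sup D (K ++ M) (atom p)) →
        (∀ (D : Base Atom) → D ⊇ C → ∀ (M : List Atom) → Hyp D M ψ → Sup D (K ++ M) (atom p)) →
        Sup C (L ++ K) (atom p)
  Sup {Atom} B L (`! φ) = ∀ (C : Base Atom) → C ⊇ B → ∀ (K : List Atom) (p : Atom) →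
        (∀ (D : Base Atom) → D ⊇ C → Sup D [] φ → Sup D K (atom p)) →
        Sup C (L ++ K) (atom p)

  -- Contribution of a single hypothesis formula in the (Inf) clause:
  -- a !δ hypothesis consumes no atoms and requires ⊩^∅ δ;
  -- any other hypothesis θ requires ⊩^M θ.
  Hyp : {Atom : Set} → Base Atom → List Atom → Formula Atom → Set₁
  Hyp B M (`! δ) = Level.Lift (Level.suc Level.zero) (M ↭ []) × Sup B [] δ
  Hyp B M θ = Sup B M θ

{-# OPTIONS --safe #-}
module Submission where

open import Defs
open import Data.List using (List; _++_)
open import Data.List.Properties using (++-assoc)
open import Relation.Binary.PropositionalEquality using (subst; sym)
open import Data.Product using (_,_)

-- Except for atoms, ⊤, & and ⊸, every support clause ends in an
-- atomic support ⊩^{K ⊎ M}_C p over an extension C of B, and ⊩^L_B 1 lets us add L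
-- there. The case ⊸ recurses on its conclusion over an extension, using that
-- 1-support is monotone in the base; & is componentwise.

private
  variable
    Atom : Set
    B C D : Base Atom

⊇-refl : (B : Base Atom) → B ⊇ B
⊇-refl B r r∈B = r∈B

⊇-trans : D ⊇ C → C ⊇ B → D ⊇ B
⊇-trans D⊇C C⊇B r r∈B = D⊇C r (C⊇B r r∈B)

Sup-1-mono : {L : List Atom} → C ⊇ B → Sup B L `1 → Sup C L `1
Sup-1-mono C⊇B one D D⊇C = one D (⊇-trans D⊇C C⊇B)

Sup-++-assoc : (L K M : List Atom) (φ : Formula Atom) →
  Sup B (L ++ (K ++ M)) φ → Sup B ((L ++ K) ++ M) φ
Sup-++-assoc {B = B} L K M φ = subst (λ N → Sup B N φ) (sym (++-assoc L K M))

Sup-1-absorb-atom : {L K M : List Atom} {p : Atom} → Sup B L `1 → C ⊇ B →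
  Sup C (K ++ M) (atom p) → Sup C ((L ++ K) ++ M) (atom p)
Sup-1-absorb-atom {C = C} {L} {K} {M} {p} one C⊇B ⊩p =
  Sup-++-assoc L K M (atom p) (one C C⊇B (K ++ M) p ⊩p)

mainTheorem10 : (Atom : Set) (B : Base Atom) (L K : List Atom) (χ : Formula Atom) →
    Sup B L `1 → Sup B K χ → Sup B (L ++ K) χ
mainTheorem10 A B L K (atom p) one ⊩χ = one B (⊇-refl B) K p ⊩χ
mainTheorem10 A B L K `⊤ one ⊩χ = ⊩χ
mainTheorem10 A B L K `0 one ⊩χ p M = Sup-1-absorb-atom one (⊇-refl B) (⊩χ p M)
mainTheorem10 A B L K `1 one ⊩χ C C⊇B M p ⊩p = Sup-1-absorb-atom one C⊇B (⊩χ C C⊇B M p ⊩p)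
mainTheorem10 A B L K (φ ⊸ ψ) one ⊩χ C C⊇B M ⊩φ =
  Sup-++-assoc L K M ψ (mainTheorem10 A C L (K ++ M) ψ (Sup-1-mono C⊇B one) (⊩χ C C⊇B M ⊩φ))
mainTheorem10 A B L K (φ ⊗ ψ) one ⊩χ C C⊇B M p elim =
  Sup-1-absorb-atom one C⊇B (⊩χ C C⊇B M p elim)
mainTheorem10 A B L K (φ & ψ) one (⊩φ , ⊩ψ) =
  mainTheorem10 A B L K φ one ⊩φ , mainTheorem10 A B L K ψ one ⊩ψ
mainTheorem10 A B L K (φ ⊕ ψ) one ⊩χ C C⊇B M p elimφ elimψ =
  Sup-1-absorb-atom one C⊇B (⊩χ C C⊇B M p elimφ elimψ)
mainTheorem10 A B L K (`! φ) one ⊩χ C C⊇B M p elim =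
  Sup-1-absorb-atom one C⊇B (⊩χ C C⊇B M p elim)
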